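{- If $G$ is a finite connected simple graph, then $\operatorname{gon}(G)=2$ if and only if $\operatorname{mfgon}(G)=2$.
   Context: A divisor is an integer combination $D=\sum_vD(v)(v)$ of vertices, degree $\sum_vD(v)$, effective if all $D(v)\ge0$. Divisors are equivalent if their difference lies in the integer column space of the Laplacian of $G$. The rank $r(D)$ is $-1$ if $D$ is not equivalent to an effective divisor, else the largest $r\ge0$ such that $D-E$ is equivalent to an effective divisor for all effective $E$ of degree $r$. $\operatorname{gon}(G)$ is the minimum degree of a positive-rank divisor; $\operatorname{mfgon}(G)$ is the minimum degree of a positive-rank effective divisor $D$ with $D(v)\le1$ for all $v$. -}

module Defs where

open import Data.Nat using (ℕ; zero; suc) renaming (_≤_ to _≤ℕ_; _<_ to _<ℕ_)
open import Data.Integer using (ℤ; +_; _+_; _-_; _*_; _≤_; -_)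
open import Data.Fin using (Fin; zero; suc; _≟_)
open import Data.Bool using (Bool; true; false; if_then_else_)
open import Data.Product using (Σ; _×_; ∃)
open import Relation.Nullary using (¬_; does)
open import Relation.Binary.PropositionalEquality using (_≡_)

∑ : ∀ {n} → (Fin n → ℤ) → ℤ
∑ {zero}  f = + 0
∑ {suc n} f = f zero + ∑ {n} (λ i → f (suc i))

record Graph : Set where
  field
    n     : ℕ
    adj   : Fin n → Fin n → Bool
    symm  : ∀ u v → adj u v ≡ adj v u
    loopless : ∀ v → adj v v ≡ false
open Graph public

data Reachable (G : Graph) : Fin (n G) → Fin (n G) → Set where
  here : ∀ {v} → Reachable G v v
  step : ∀ {u w v} → adj G u w ≡ true → Reachable G w v → Reachable G u v

Connected : Graph → Set
Connected G = (0 <ℕ n G) × (∀ u v → Reachable G u v)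

Divisor : Graph → Set
Divisor G = Fin (n G) → ℤ

degree : ∀ {G} → Divisor G → ℤ
degree D = ∑ D

Effective : ∀ {G} → Divisor G → Set
Effective D = ∀ v → + 0 ≤ D v

valence : (G : Graph) → Fin (n G) → ℤ
valence G v = ∑ (λ u → if adj G v u then + 1 else + 0)

Laplacian : (G : Graph) → Fin (n G) → Fin (n G) → ℤ
Laplacian G v u =
  if does (v ≟ u) then valence G v
  else (if adj G v u then - (+ 1) else + 0)

Equiv : (G : Graph) → Divisor G → Divisor G → Set
Equiv G D D' = Σ (Fin (n G) → ℤ) λ f → ∀ v → D v - D' v ≡ ∑ (λ u → Laplacian G v u * f u)

EquivEffective : ∀ {G} → Divisor G → Set
EquivEffective {G} D = Σ (Divisor G) λ D' → Effective {G} D' × Equiv G D D'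

RankCond : ∀ {G} → Divisor G → ℕ → Set
RankCond {G} D r = ∀ (E : Divisor G) → Effective {G} E → degree {G} E ≡ + r →
  EquivEffective {G} (λ v → D v - E v)

-- r(D) ≥ 1: D is equivalent to an effective divisor and the largest r
-- satisfying RankCond is ≥ 1, i.e. RankCond holds for some r ≥ 1.
PositiveRank : ∀ {G} → Divisor G → Set
PositiveRank {G} D = EquivEffective {G} D × Σ ℕ λ r → (1 ≤ℕ r) × RankCond {G} D r

GonalityIs : Graph → ℤ → Set
GonalityIs G k =
  (Σ (Divisor G) λ D → PositiveRank {G} D × degree {G} D ≡ k)
  × (∀ (D : Divisor G) → PositiveRank {G} D → k ≤ degree {G} D)

MultFree : ∀ {G} → Divisor G → Set
MultFree {G} D = Effective {G} D × (∀ v → D v ≤ + 1)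

MFGonalityIs : Graph → ℤ → Set
MFGonalityIs G k =
  (Σ (Divisor G) λ D → MultFree {G} D × PositiveRank {G} D × degree {G} D ≡ k)
  × (∀ (D : Divisor G) → MultFree {G} D → PositiveRank {G} D → k ≤ degree {G} D)

{-# OPTIONS --safe #-}
module Submission where

-- Let D be an effective divisor of degree 2 and positive rank, which exists when gon G = 2.
-- If D is not multiplicity-free then D = 2(v). Some vertex u differs from v, since otherwise
-- (v) would have positive rank and gon G would be 1; as D - r(u) is equivalent to an effective
-- divisor, there is a script f with D - Δ f ≥ 0 and (D - Δ f)(u) > 0. Let S be the set where f
-- is maximal. For x ∈ S, 0 ≤ Δ 𝟙_S x ≤ Δ f x ≤ D x; hence u ∉ S, and since D vanishes off v,
-- v is the only vertex of S with neighbours outside S (it is one, G being connected). So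
-- D - Δ 𝟙_S = (2 - k)(v) + (the k ≥ 1 neighbours of v outside S) is multiplicity-free.
-- Conversely, an effective divisor of degree ≤ 1 is multiplicity-free, so mfgon G = 2 rules
-- out positive rank below degree 2.

open import Defs
open import Data.Integer using (+_)
open import Function.Bundles using (_⇔_; mk⇔)

open import Data.Bool using (Bool; true; false; if_then_else_)
open import Data.Fin using (Fin; zero; suc; _≟_)
open import Data.Fin.Properties using (suc-injective; all?; ¬∀⟶∃¬)
open import Data.Integer using (ℤ; _+_; _-_; _*_; -_; _≤_; _<_; +≤+; -≤+)
open import Data.Integer.Properties renaming (_≟_ to _≟ℤ_)
open import Data.Nat using (zero; suc; z≤n; s≤s)
open import Data.Product using (Σ; _×_; _,_; proj₂)
open import Function.Base using (_∘_)
open import Data.List.Base using (allFin)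
import Data.List.Relation.Unary.All as All
open import Data.List.Membership.Propositional.Properties using (∈-allFin)
open import Data.List.Extrema ≤-totalOrder using (argmax; f[xs]≤f[argmax])
open import Relation.Nullary using (does; yes; no; contradiction)
open import Relation.Binary.PropositionalEquality
open import Data.Integer.Tactic.RingSolver using (solve-∀)
open import Algebra.Properties.CommutativeSemigroup +-commutativeSemigroup using (interchange)

-- Finite sums

∑-cong : ∀ {n} {f g : Fin n → ℤ} → (∀ i → f i ≡ g i) → ∑ f ≡ ∑ g
∑-cong {zero}  f≗g = refl
∑-cong {suc n} f≗g = cong₂ _+_ (f≗g zero) (∑-cong (f≗g ∘ suc))

∑-zero : ∀ n → ∑ {n} (λ _ → + 0) ≡ + 0
∑-zero zero    = refl
∑-zero (suc n) = trans (+-identityˡ _) (∑-zero n)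

∑-+ : ∀ {n} (f g : Fin n → ℤ) → ∑ (λ i → f i + g i) ≡ ∑ f + ∑ g
∑-+ {zero}  f g = refl
∑-+ {suc n} f g = trans (cong (_+_ (f zero + g zero)) (∑-+ (f ∘ suc) (g ∘ suc)))
                       (interchange (f zero) (g zero) (∑ (f ∘ suc)) (∑ (g ∘ suc)))

∑-neg : ∀ {n} (f : Fin n → ℤ) → ∑ (λ i → - f i) ≡ - ∑ f
∑-neg {zero}  f = refl
∑-neg {suc n} f = trans (cong (_+_ (- f zero)) (∑-neg (f ∘ suc))) (sym (neg-distrib-+ (f zero) _))

∑-- : ∀ {n} (f g : Fin n → ℤ) → ∑ (λ i → f i - g i) ≡ ∑ f - ∑ g
∑-- f g = trans (∑-+ f (λ i → - g i)) (cong (_+_ (∑ f)) (∑-neg g))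

∑-*ʳ : ∀ {n} (f : Fin n → ℤ) c → ∑ (λ i → f i * c) ≡ ∑ f * c
∑-*ʳ {zero}  f c = sym (*-zeroˡ c)
∑-*ʳ {suc n} f c = trans (cong (_+_ (f zero * c)) (∑-*ʳ (f ∘ suc) c)) (sym (*-distribʳ-+ c (f zero) _))

∑-comm : ∀ {m n} (A : Fin m → Fin n → ℤ) → ∑ (λ i → ∑ (A i)) ≡ ∑ (λ j → ∑ (λ i → A i j))
∑-comm {zero}  {n} A = sym (∑-zero n)
∑-comm {suc m}     A = trans (cong (_+_ (∑ (A zero))) (∑-comm (A ∘ suc)))
                             (sym (∑-+ (A zero) (λ j → ∑ (λ i → A (suc i) j))))

∑-supported : ∀ {n} {f : Fin n → ℤ} v → (∀ w → w ≢ v → f w ≡ + 0) → ∑ f ≡ f v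
∑-supported {suc n} {f} zero    off = begin
  f zero + ∑ (f ∘ suc)      ≡⟨ cong (_+_ (f zero)) (trans (∑-cong (λ w → off (suc w) λ ())) (∑-zero n)) ⟩
  f zero + + 0              ≡⟨ +-identityʳ (f zero) ⟩
  f zero                    ∎
  where open ≡-Reasoning
∑-supported {suc n} {f} (suc v) off = begin
  f zero + ∑ (f ∘ suc)      ≡⟨ cong (_+ ∑ (f ∘ suc)) (off zero λ ()) ⟩
  + 0 + ∑ (f ∘ suc)         ≡⟨ +-identityˡ _ ⟩
  ∑ (f ∘ suc)               ≡⟨ ∑-supported v (λ w w≢v → off (suc w) (w≢v ∘ suc-injective)) ⟩
  f (suc v)                 ∎
  where open ≡-Reasoning

∑-mono-≤ : ∀ {n} {f g : Fin n → ℤ} → (∀ i → f i ≤ g i) → ∑ f ≤ ∑ g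
∑-mono-≤ {zero}  f≤g = ≤-refl
∑-mono-≤ {suc n} f≤g = +-mono-≤ (f≤g zero) (∑-mono-≤ (f≤g ∘ suc))

∑-nonneg : ∀ {n} {f : Fin n → ℤ} → (∀ i → + 0 ≤ f i) → + 0 ≤ ∑ f
∑-nonneg {n} 0≤f = ≤-trans (≤-reflexive (sym (∑-zero n))) (∑-mono-≤ 0≤f)

∑-nonpos : ∀ {n} {f : Fin n → ℤ} → (∀ i → f i ≤ + 0) → ∑ f ≤ + 0
∑-nonpos {n} f≤0 = ≤-trans (∑-mono-≤ f≤0) (≤-reflexive (∑-zero n))

term≤∑ : ∀ {n} {f : Fin n → ℤ} → (∀ i → + 0 ≤ f i) → ∀ j → f j ≤ ∑ f
term≤∑ {suc n} {f} 0≤f zero    = ≤-trans (≤-reflexive (sym (+-identityʳ (f zero))))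
                                          (+-monoʳ-≤ (f zero) (∑-nonneg (0≤f ∘ suc)))
term≤∑ {suc n} {f} 0≤f (suc j) = ≤-trans (term≤∑ (0≤f ∘ suc) j)
                                          (≤-trans (≤-reflexive (sym (+-identityˡ _))) (+-monoˡ-≤ _ (0≤f zero)))

pair≤∑ : ∀ {n} {f : Fin n → ℤ} → (∀ i → + 0 ≤ f i) → ∀ {i j} → i ≢ j → f i + f j ≤ ∑ f
pair≤∑ {suc n} {f} 0≤f {zero}  {zero}  i≢j = contradiction refl i≢j
pair≤∑ {suc n} {f} 0≤f {zero}  {suc j} i≢j = +-monoʳ-≤ (f zero) (term≤∑ (0≤f ∘ suc) j)
pair≤∑ {suc n} {f} 0≤f {suc i} {zero}  i≢j =
  ≤-trans (≤-reflexive (+-comm (f (suc i)) (f zero))) (+-monoʳ-≤ (f zero) (term≤∑ (0≤f ∘ suc) i))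
pair≤∑ {suc n} {f} 0≤f {suc i} {suc j} i≢j =
  ≤-trans (pair≤∑ (0≤f ∘ suc) (i≢j ∘ cong suc))
          (≤-trans (≤-reflexive (sym (+-identityˡ _))) (+-monoˡ-≤ _ (0≤f zero)))

i<j⇒1≤j-i : ∀ {i j} → i < j → + 1 ≤ j - i
i<j⇒1≤j-i {i} {j} i<j = begin
  + 1             ≡⟨ +-identityʳ (+ 1) ⟨
  + 1 + + 0       ≡⟨ cong (_+_ (+ 1)) (+-inverseʳ i) ⟨
  + 1 + (i - i)   ≡⟨ +-assoc (+ 1) i (- i) ⟨
  + 1 + i - i     ≤⟨ +-monoˡ-≤ (- i) (i<j⇒suc[i]≤j i<j) ⟩
  j - i           ∎
  where open ≤-Reasoning

infix 7 _·⟨_⟩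

_·⟨_⟩ : ∀ {n} → ℤ → Fin n → Fin n → ℤ
(k ·⟨ v ⟩) w = if does (w ≟ v) then k else + 0

·⟨⟩-at : ∀ {n} k (v : Fin n) → (k ·⟨ v ⟩) v ≡ k
·⟨⟩-at k v with v ≟ v
... | yes _   = refl
... | no v≢v = contradiction refl v≢v

·⟨⟩-off : ∀ {n} k {v w : Fin n} → w ≢ v → (k ·⟨ v ⟩) w ≡ + 0
·⟨⟩-off k {v} {w} w≢v with w ≟ v
... | yes w≡v = contradiction w≡v w≢v
... | no _    = refl

·⟨⟩-nonneg : ∀ {n} {k} (v : Fin n) → + 0 ≤ k → ∀ w → + 0 ≤ (k ·⟨ v ⟩) w
·⟨⟩-nonneg v 0≤k w with w ≟ v
... | yes _ = 0≤k
... | no _  = ≤-refl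

∑-·⟨⟩ : ∀ {n} k (v : Fin n) → ∑ (k ·⟨ v ⟩) ≡ k
∑-·⟨⟩ k v = trans (∑-supported v (λ _ → ·⟨⟩-off k)) (·⟨⟩-at k v)

𝟙 : ∀ {n} → (Fin n → Bool) → Fin n → ℤ
𝟙 S w = if S w then + 1 else + 0

-- The Laplacian and linear equivalence

module _ {G : Graph} where

  private
    V : Set
    V = Fin (n G)

  Δ : (V → ℤ) → V → ℤ
  Δ h x = ∑ (λ w → Laplacian G x w * h w)

  Laplacian-sym : ∀ x w → Laplacian G x w ≡ Laplacian G w x
  Laplacian-sym x w with x ≟ w | w ≟ x
  ... | yes refl | yes _    = refl
  ... | yes refl | no w≢x   = contradiction refl w≢x
  ... | no x≢w   | yes refl = contradiction refl x≢w
  ... | no _     | no _     rewrite symm G x w = refl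

  valence-*ʳ : ∀ x c → valence G x * c ≡ ∑ (λ w → if adj G x w then c else + 0)
  valence-*ʳ x c = trans (sym (∑-*ʳ (λ w → if adj G x w then + 1 else + 0) c)) (∑-cong term)
    where
    term : ∀ w → (if adj G x w then + 1 else + 0) * c ≡ (if adj G x w then c else + 0)
    term w with adj G x w
    ... | true  = *-identityˡ c
    ... | false = *-zeroˡ c

  Laplacian-*-split : ∀ (h : V → ℤ) x w →
    Laplacian G x w * h w ≡ ((valence G x * h x) ·⟨ x ⟩) w - (if adj G x w then h w else + 0)
  Laplacian-*-split h x w with w ≟ x | x ≟ w
  ... | yes refl | yes _    rewrite loopless G x = sym (+-identityʳ _)
  ... | yes refl | no x≢x   = contradiction refl x≢x
  ... | no w≢x   | yes refl = contradiction refl w≢x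
  ... | no _     | no _     with adj G x w
  ...   | true  = trans (-1*i≡-i (h w)) (sym (+-identityˡ _))
  ...   | false = *-zeroˡ (h w)

  flow : (V → ℤ) → V → V → ℤ
  flow h x w = if adj G x w then h x - h w else + 0

  Δ-local : ∀ h x → Δ h x ≡ ∑ (flow h x)
  Δ-local h x = begin
    Δ h x                                          ≡⟨ ∑-cong (Laplacian-*-split h x) ⟩
    ∑ (λ w → ((valence G x * h x) ·⟨ x ⟩) w - B w) ≡⟨ ∑-- _ B ⟩
    ∑ ((valence G x * h x) ·⟨ x ⟩) - ∑ B           ≡⟨ cong (_- ∑ B) (∑-·⟨⟩ _ x) ⟩
    valence G x * h x - ∑ B                        ≡⟨ cong (_- ∑ B) (valence-*ʳ x (h x)) ⟩
    ∑ C - ∑ B                                      ≡⟨ ∑-- C B ⟨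
    ∑ (λ w → C w - B w)                            ≡⟨ ∑-cong C-B ⟩
    ∑ (flow h x)                                   ∎
    where
    open ≡-Reasoning
    B C : V → ℤ
    B w = if adj G x w then h w else + 0
    C w = if adj G x w then h x else + 0
    C-B : ∀ w → C w - B w ≡ flow h x w
    C-B w with adj G x w
    ... | true  = refl
    ... | false = refl

  Δ-const : ∀ c x → Δ (λ _ → c) x ≡ + 0
  Δ-const c x = trans (Δ-local (λ _ → c) x) (trans (∑-cong c-c) (∑-zero (n G)))
    where
    c-c : ∀ w → flow (λ _ → c) x w ≡ + 0
    c-c w with adj G x w
    ... | true  = +-inverseʳ c
    ... | false = refl

  Δ-+ : ∀ h k x → Δ (λ w → h w + k w) x ≡ Δ h x + Δ k x
  Δ-+ h k x = trans (∑-cong (λ w → *-distribˡ-+ (Laplacian G x w) (h w) (k w)))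
                    (∑-+ (λ w → Laplacian G x w * h w) (λ w → Laplacian G x w * k w))

  Δ-neg : ∀ h x → Δ (λ w → - h w) x ≡ - Δ h x
  Δ-neg h x = trans (∑-cong (λ w → sym (neg-distribʳ-* (Laplacian G x w) (h w))))
                    (∑-neg (λ w → Laplacian G x w * h w))

  ∑-Δ : ∀ h → ∑ (Δ h) ≡ + 0
  ∑-Δ h = begin
    ∑ (λ x → ∑ (λ w → Laplacian G x w * h w))
      ≡⟨ ∑-comm (λ x w → Laplacian G x w * h w) ⟩
    ∑ (λ w → ∑ (λ x → Laplacian G x w * h w))
      ≡⟨ ∑-cong (λ w → ∑-cong (λ x → cong (_* h w) (Laplacian-sym x w))) ⟩
    ∑ (λ w → Δ (λ _ → h w) w)
      ≡⟨ ∑-cong (λ w → Δ-const (h w) w) ⟩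
    ∑ {n G} (λ _ → + 0)
      ≡⟨ ∑-zero (n G) ⟩
    + 0 ∎
    where open ≡-Reasoning

  Equiv-refl : ∀ D → Equiv G D D
  Equiv-refl D = (λ _ → + 0) , λ x → trans (+-inverseʳ (D x)) (sym (Δ-const (+ 0) x))

  Equiv-sym : ∀ {D D'} → Equiv G D D' → Equiv G D' D
  Equiv-sym {D} {D'} (f , D-D'≡Δf) = (λ w → - f w) , λ x → begin
    D' x - D x        ≡⟨ swap-minus (D x) (D' x) ⟩
    - (D x - D' x)    ≡⟨ cong -_ (D-D'≡Δf x) ⟩
    - Δ f x           ≡⟨ Δ-neg f x ⟨
    Δ (λ w → - f w) x ∎
    where
    open ≡-Reasoning
    swap-minus : ∀ a b → b - a ≡ - (a - b)
    swap-minus = solve-∀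

  Equiv-trans : ∀ {D D' D''} → Equiv G D D' → Equiv G D' D'' → Equiv G D D''
  Equiv-trans {D} {D'} {D''} (f , D-D'≡Δf) (g , D'-D''≡Δg) = (λ w → f w + g w) , λ x → begin
    D x - D'' x                   ≡⟨ +-minus-telescope (D x) (D' x) (D'' x) ⟨
    (D x - D' x) + (D' x - D'' x) ≡⟨ cong₂ _+_ (D-D'≡Δf x) (D'-D''≡Δg x) ⟩
    Δ f x + Δ g x                 ≡⟨ Δ-+ f g x ⟨
    Δ (λ w → f w + g w) x         ∎
    where open ≡-Reasoning

  Equiv-−ʳ : ∀ {D D'} (E : Divisor G) →
    Equiv G D D' → Equiv G (λ w → D w - E w) (λ w → D' w - E w)
  Equiv-−ʳ {D} {D'} E (f , D-D'≡Δf) = f , λ x → trans (cancel (D x) (D' x) (E x)) (D-D'≡Δf x)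
    where
    cancel : ∀ a b c → (a - c) - (b - c) ≡ a - b
    cancel = solve-∀

  Equiv⇒degree≡ : ∀ {D D'} → Equiv G D D' → degree {G} D ≡ degree {G} D'
  Equiv⇒degree≡ {D} {D'} (f , D-D'≡Δf) = i-j≡0⇒i≡j (∑ D) (∑ D') (begin
    ∑ D - ∑ D'            ≡⟨ ∑-- D D' ⟨
    ∑ (λ w → D w - D' w)  ≡⟨ ∑-cong D-D'≡Δf ⟩
    ∑ (Δ f)               ≡⟨ ∑-Δ f ⟩
    + 0                   ∎)
    where open ≡-Reasoning

  EquivEffective-resp-Equiv : ∀ {D D'} → Equiv G D D' → EquivEffective {G} D → EquivEffective {G} D'
  EquivEffective-resp-Equiv {D} {D'} D~D' (D₀ , D₀≥0 , D~D₀) =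
    D₀ , D₀≥0 , Equiv-trans {D'} {D} {D₀} (Equiv-sym {D} {D'} D~D') D~D₀

  PositiveRank-resp-Equiv : ∀ {D D'} → Equiv G D D' → PositiveRank {G} D → PositiveRank {G} D'
  PositiveRank-resp-Equiv {D} {D'} D~D' (D≈eff , r , 1≤r , rank-r) =
    EquivEffective-resp-Equiv {D} {D'} D~D' D≈eff , r , 1≤r ,
    λ E E≥0 degE → EquivEffective-resp-Equiv {λ w → D w - E w} {λ w → D' w - E w}
                     (Equiv-−ʳ {D} {D'} E D~D') (rank-r E E≥0 degE)

  -- Firing a set of vertices

  flow𝟙-nonneg : ∀ {S x} → S x ≡ true → ∀ w → + 0 ≤ flow (𝟙 S) x w
  flow𝟙-nonneg {S} {x} Sx w rewrite Sx with adj G x w | S w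
  ... | false | _     = ≤-refl
  ... | true  | true  = ≤-refl
  ... | true  | false = +≤+ z≤n

  Δ𝟙-nonneg : ∀ {S x} → S x ≡ true → + 0 ≤ Δ (𝟙 S) x
  Δ𝟙-nonneg {S} {x} Sx =
    ≤-trans (∑-nonneg (flow𝟙-nonneg {S} Sx)) (≤-reflexive (sym (Δ-local (𝟙 S) x)))

  Δ𝟙-nonpos : ∀ {S x} → S x ≡ false → Δ (𝟙 S) x ≤ + 0
  Δ𝟙-nonpos {S} {x} ¬Sx = ≤-trans (≤-reflexive (Δ-local (𝟙 S) x)) (∑-nonpos flow≤0)
    where
    flow≤0 : ∀ w → flow (𝟙 S) x w ≤ + 0
    flow≤0 w rewrite ¬Sx with adj G x w | S w
    ... | false | _     = ≤-refl
    ... | true  | true  = -≤+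
    ... | true  | false = ≤-refl

  Δ𝟙-exit : ∀ {S x y} → S x ≡ true → adj G x y ≡ true → S y ≡ false → + 1 ≤ Δ (𝟙 S) x
  Δ𝟙-exit {S} {x} {y} Sx x∼y ¬Sy = begin
    + 1                ≡⟨ flow-y ⟨
    flow (𝟙 S) x y     ≤⟨ term≤∑ (flow𝟙-nonneg {S} Sx) y ⟩
    ∑ (flow (𝟙 S) x)   ≡⟨ Δ-local (𝟙 S) x ⟨
    Δ (𝟙 S) x          ∎
    where
    open ≤-Reasoning
    flow-y : flow (𝟙 S) x y ≡ + 1
    flow-y rewrite x∼y | Sx | ¬Sy = refl

  Δ𝟙-single-entry : ∀ {S x v} → S x ≡ false → (∀ w → adj G x w ≡ true → S w ≡ true → w ≡ v) →
                    - + 1 ≤ Δ (𝟙 S) x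
  Δ𝟙-single-entry {S} {x} {v} ¬Sx entry≡v = begin
    - + 1                          ≡⟨ cong -_ (∑-·⟨⟩ (+ 1) v) ⟨
    - ∑ (+ 1 ·⟨ v ⟩)               ≡⟨ ∑-neg (+ 1 ·⟨ v ⟩) ⟨
    ∑ (λ w → - (+ 1 ·⟨ v ⟩) w)     ≤⟨ ∑-mono-≤ bound ⟩
    ∑ (flow (𝟙 S) x)               ≡⟨ Δ-local (𝟙 S) x ⟨
    Δ (𝟙 S) x                      ∎
    where
    open ≤-Reasoning
    -point≤0 : ∀ w → - (+ 1 ·⟨ v ⟩) w ≤ + 0
    -point≤0 w = neg-mono-≤ (·⟨⟩-nonneg v (+≤+ z≤n) w)
    bound : ∀ w → - (+ 1 ·⟨ v ⟩) w ≤ flow (𝟙 S) x w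
    bound w rewrite ¬Sx with adj G x w in x∼w | S w in Sw
    ... | false | _     = -point≤0 w
    ... | true  | false = -point≤0 w
    ... | true  | true  with entry≡v w x∼w Sw
    ...   | refl = ≤-reflexive (cong -_ (·⟨⟩-at (+ 1) w))

  Δ𝟙≤Δ : ∀ {S x} (f : V → ℤ) → S x ≡ true →
         (∀ w → f w ≤ f x) → (∀ w → S w ≡ false → f w < f x) → Δ (𝟙 S) x ≤ Δ f x
  Δ𝟙≤Δ {S} {x} f Sx f≤fx outside< = begin
    Δ (𝟙 S) x          ≡⟨ Δ-local (𝟙 S) x ⟩
    ∑ (flow (𝟙 S) x)   ≤⟨ ∑-mono-≤ bound ⟩
    ∑ (flow f x)       ≡⟨ Δ-local f x ⟨
    Δ f x              ∎
    where
    open ≤-Reasoning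
    bound : ∀ w → flow (𝟙 S) x w ≤ flow f x w
    bound w rewrite Sx with adj G x w | S w in Sw
    ... | false | _     = ≤-refl
    ... | true  | true  = i≤j⇒0≤j-i (f≤fx w)
    ... | true  | false = i<j⇒1≤j-i (outside< w Sw)

  exit-edge : ∀ {S : V → Bool} {a b} → Reachable G a b → S a ≡ true → S b ≡ false →
              Σ V λ x → Σ V λ y → S x ≡ true × adj G x y ≡ true × S y ≡ false
  exit-edge here Sa ¬Sb with () ← trans (sym Sa) ¬Sb
  exit-edge {S} (step {w = w} a∼w w⇝b) Sa ¬Sb with S w in Sw
  ... | true  = exit-edge w⇝b Sw ¬Sb
  ... | false = _ , w , Sa , a∼w , Sw
module Maximizers {G : Graph} (f : Fin (n G) → ℤ) (w₀ : Fin (n G)) where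

  top : Fin (n G)
  top = argmax f w₀ (allFin (n G))

  S : Fin (n G) → Bool
  S w = does (f w ≟ℤ f top)

  f≤f[top] : ∀ w → f w ≤ f top
  f≤f[top] w = All.lookup (f[xs]≤f[argmax] w₀ (allFin (n G))) (∈-allFin w)

  S-top : S top ≡ true
  S-top with f top ≟ℤ f top
  ... | yes _   = refl
  ... | no ≢top = contradiction refl ≢top

  S-true : ∀ {x} → S x ≡ true → f x ≡ f top
  S-true {x} with f x ≟ℤ f top
  ... | yes eq = λ _ → eq
  ... | no _   = λ ()

  S-false : ∀ {x} → S x ≡ false → f x ≢ f top
  S-false {x} with f x ≟ℤ f top
  ... | yes _    = λ ()
  ... | no ≢top = λ _ → ≢top

  Δ𝟙S≤Δf : ∀ {x} → S x ≡ true → Δ {G} (𝟙 S) x ≤ Δ {G} f x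
  Δ𝟙S≤Δf {x} Sx = Δ𝟙≤Δ {G} f Sx f≤f[x] outside<
    where
    f≤f[x] : ∀ w → f w ≤ f x
    f≤f[x] w = ≤-trans (f≤f[top] w) (≤-reflexive (sym (S-true Sx)))
    outside< : ∀ w → S w ≡ false → f w < f x
    outside< w ¬Sw = <-≤-trans (≤∧≢⇒< (f≤f[top] w) (S-false ¬Sw)) (f≤f[x] top)

module Firing {G : Graph} (connected : ∀ a b → Reachable G a b) {D : Divisor G} {v u : Fin (n G)}
  (D≥0 : Effective {G} D) (D≤0-off-v : ∀ w → w ≢ v → D w ≤ + 0) (Dv≤2 : D v ≤ + 2)
  (u≢v : u ≢ v) (f : Fin (n G) → ℤ)
  (D-Δf≥0 : ∀ w → + 0 ≤ D w - Δ {G} f w) (D-Δf-at-u : + 1 ≤ D u - Δ {G} f u)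
  where

  open Maximizers {G} f u

  Δ𝟙S≤D : ∀ {x} → S x ≡ true → Δ {G} (𝟙 S) x ≤ D x
  Δ𝟙S≤D {x} Sx = ≤-trans (Δ𝟙S≤Δf Sx) (0≤i-j⇒j≤i (D-Δf≥0 x))

  u∉S : S u ≡ false
  u∉S with S u in Su
  ... | false = refl
  ... | true
    with +≤+ () ← ≤-trans D-Δf-at-u
                    (+-mono-≤ (D≤0-off-v u u≢v) (neg-mono-≤ (≤-trans (Δ𝟙-nonneg {G} {S} Su) (Δ𝟙S≤Δf Su))))

  exit≡v : ∀ {x y} → S x ≡ true → adj G x y ≡ true → S y ≡ false → x ≡ v
  exit≡v {x} Sx x∼y ¬Sy with x ≟ v
  ... | yes x≡v = x≡v
  ... | no x≢v
    with +≤+ () ← ≤-trans (Δ𝟙-exit {G} {S} Sx x∼y ¬Sy) (≤-trans (Δ𝟙S≤D Sx) (D≤0-off-v x x≢v))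

  entry≡v : ∀ {x w} → S x ≡ false → adj G x w ≡ true → S w ≡ true → w ≡ v
  entry≡v {x} {w} ¬Sx x∼w Sw = exit≡v Sw (trans (symm G w x) x∼w) ¬Sx

  v-exit : S v ≡ true × + 1 ≤ Δ {G} (𝟙 S) v
  v-exit with exit-edge {G} {S} (connected top u) S-top u∉S
  ... | x , y , Sx , x∼y , ¬Sy with exit≡v Sx x∼y ¬Sy
  ...   | refl = Sx , Δ𝟙-exit {G} {S} Sx x∼y ¬Sy

  fired : Divisor G
  fired w = D w - Δ {G} (𝟙 S) w

  fired≥0 : Effective {G} fired
  fired≥0 x with S x in Sx
  ... | true  = i≤j⇒0≤j-i (Δ𝟙S≤D Sx)
  ... | false = i≤j⇒0≤j-i (≤-trans (Δ𝟙-nonpos {G} {S} Sx) (D≥0 x))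

  fired≤1 : ∀ x → fired x ≤ + 1
  fired≤1 x with x ≟ v
  ... | yes refl = +-mono-≤ Dv≤2 (neg-mono-≤ (proj₂ v-exit))
  ... | no x≢v   = +-mono-≤ (D≤0-off-v x x≢v) (neg-mono-≤ Δ𝟙S≥-1)
    where
    Δ𝟙S≥-1 : - + 1 ≤ Δ {G} (𝟙 S) x
    Δ𝟙S≥-1 with S x in Sx
    ... | true  = ≤-trans -≤+ (Δ𝟙-nonneg {G} {S} Sx)
    ... | false = Δ𝟙-single-entry {G} {S} Sx (λ w → entry≡v Sx)

  D~fired : Equiv G D fired
  D~fired = 𝟙 S , λ x → cancel (D x) (Δ {G} (𝟙 S) x)
    where
    cancel : ∀ a b → a - (a - b) ≡ b
    cancel = solve-∀

module _ {G : Graph} where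

  private
    V : Set
    V = Fin (n G)

  effective-degree≤1⇒multFree : ∀ {D : Divisor G} →
    Effective {G} D → degree {G} D ≤ + 1 → MultFree {G} D
  effective-degree≤1⇒multFree D≥0 deg≤1 = D≥0 , λ w → ≤-trans (term≤∑ D≥0 w) deg≤1

  effective-degree2-concentrated : ∀ {D : Divisor G} {v} → Effective {G} D → degree {G} D ≡ + 2 →
    + 2 ≤ D v → ∀ w → w ≢ v → D w ≤ + 0
  effective-degree2-concentrated {D} {v} D≥0 deg≡2 2≤Dv w w≢v = begin
    D w               ≡⟨ add-sub (D w) (D v) ⟩
    D w + D v - D v   ≤⟨ +-mono-≤ (≤-trans (pair≤∑ D≥0 w≢v) (≤-reflexive deg≡2)) (neg-mono-≤ 2≤Dv) ⟩
    + 2 - + 2         ∎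
    where
    open ≤-Reasoning
    add-sub : ∀ a b → a ≡ a + b - b
    add-sub = solve-∀

  only-vertex⇒positiveRank : ∀ {v : V} → (∀ w → w ≡ v) → PositiveRank {G} (+ 1 ·⟨ v ⟩)
  only-vertex⇒positiveRank {v} only-v =
    (+ 1 ·⟨ v ⟩ , ·⟨⟩-nonneg v (+≤+ z≤n) , Equiv-refl {G} (+ 1 ·⟨ v ⟩)) , 1 , s≤s z≤n , rank-1
    where
    rank-1 : RankCond {G} (+ 1 ·⟨ v ⟩) 1
    rank-1 E E≥0 degE = (λ w → (+ 1 ·⟨ v ⟩) w - E w) , (λ w → ≤-reflexive (sym (cancels w))) ,
                        Equiv-refl {G} (λ w → (+ 1 ·⟨ v ⟩) w - E w)
      where
      E[v]≡1 : E v ≡ + 1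
      E[v]≡1 = trans (sym (∑-supported v (λ w w≢v → contradiction (only-v w) w≢v))) degE
      cancels : ∀ w → (+ 1 ·⟨ v ⟩) w - E w ≡ + 0
      cancels w rewrite only-v w | ·⟨⟩-at (+ 1) v | E[v]≡1 = refl

  positiveRank⇒script : ∀ {D} → PositiveRank {G} D → ∀ u →
    Σ (V → ℤ) λ f → (∀ w → + 0 ≤ D w - Δ {G} f w) × + 1 ≤ D u - Δ {G} f u
  positiveRank⇒script {D} (_ , r , 1≤r , rank-r) u
    with rank-r (+ r ·⟨ u ⟩) (·⟨⟩-nonneg u (+≤+ z≤n)) (∑-·⟨⟩ (+ r) u)
  ... | F , F≥0 , f , D-E-F≡Δf = f , D-Δf≥0 , D-Δf-at-u
    where
    E : V → ℤ
    E = + r ·⟨ u ⟩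
    D-Δf≡E+F : ∀ w → D w - Δ {G} f w ≡ E w + F w
    D-Δf≡E+F w = trans (cong (_-_ (D w)) (sym (D-E-F≡Δf w))) (rearrange (D w) (E w) (F w))
      where
      rearrange : ∀ d e f → d - ((d - e) - f) ≡ e + f
      rearrange = solve-∀
    D-Δf≥0 : ∀ w → + 0 ≤ D w - Δ {G} f w
    D-Δf≥0 w = ≤-trans (+-mono-≤ (·⟨⟩-nonneg u (+≤+ z≤n) w) (F≥0 w)) (≤-reflexive (sym (D-Δf≡E+F w)))
    D-Δf-at-u : + 1 ≤ D u - Δ {G} f u
    D-Δf-at-u = begin
      + 1             ≤⟨ +≤+ 1≤r ⟩
      + r             ≡⟨ ·⟨⟩-at (+ r) u ⟨
      E u             ≡⟨ +-identityʳ (E u) ⟨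
      E u + + 0       ≤⟨ +-monoʳ-≤ (E u) (F≥0 u) ⟩
      E u + F u       ≡⟨ D-Δf≡E+F u ⟨
      D u - Δ {G} f u ∎
      where open ≤-Reasoning

  multFree-representative : Connected G → (∀ D → PositiveRank {G} D → + 2 ≤ degree {G} D) →
    ∀ {D} → Effective {G} D → degree {G} D ≡ + 2 → PositiveRank {G} D →
    Σ (Divisor G) λ D' → MultFree {G} D' × Equiv G D D'
  multFree-representative (_ , connected) gon≥2 {D} D≥0 deg≡2 D-rank
    with all? (λ w → D w ≤? + 1)
  ... | yes D≤1 = D , (D≥0 , D≤1) , Equiv-refl {G} D
  ... | no ¬D≤1
    with v , ¬Dv≤1 ← ¬∀⟶∃¬ (n G) (λ w → D w ≤ + 1) (λ w → D w ≤? + 1) ¬D≤1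
    with all? (_≟ v)
  ... | yes only-v
    with +≤+ (s≤s ()) ← ≤-trans (gon≥2 _ (only-vertex⇒positiveRank only-v)) (≤-reflexive (∑-·⟨⟩ (+ 1) v))
  ... | no ¬only-v
    with u , u≢v ← ¬∀⟶∃¬ (n G) (_≡ v) (_≟ v) ¬only-v
    with f , D-Δf≥0 , D-Δf-at-u ← positiveRank⇒script {D} D-rank u
    = fired , (fired≥0 , fired≤1) , D~fired
    where
    2≤Dv : + 2 ≤ D v
    2≤Dv = i<j⇒suc[i]≤j (≰⇒> ¬Dv≤1)
    open Firing connected {D} {v} {u} D≥0 (effective-degree2-concentrated D≥0 deg≡2 2≤Dv)
                (≤-trans (term≤∑ D≥0 v) (≤-reflexive deg≡2)) u≢v f D-Δf≥0 D-Δf-at-u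

  positiveRank⇒effective : ∀ {D} → PositiveRank {G} D →
    Σ (Divisor G) λ D₁ → Effective {G} D₁ × PositiveRank {G} D₁ × degree {G} D₁ ≡ degree {G} D
  positiveRank⇒effective {D} D-rank@((D₁ , D₁≥0 , D~D₁) , _) =
    D₁ , D₁≥0 , PositiveRank-resp-Equiv {G} {D} {D₁} D~D₁ D-rank , sym (Equiv⇒degree≡ {G} {D} {D₁} D~D₁)

  gon2⇒mfgon2 : Connected G → GonalityIs G (+ 2) → MFGonalityIs G (+ 2)
  gon2⇒mfgon2 conn ((D , D-rank , deg≡2) , gon≥2)
    with D₁ , D₁≥0 , D₁-rank , deg₁≡deg ← positiveRank⇒effective {D} D-rank
    with D₂ , D₂-multFree , D₁~D₂ ← multFree-representative conn gon≥2 D₁≥0 (trans deg₁≡deg deg≡2) D₁-rank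
    = (D₂ , D₂-multFree , PositiveRank-resp-Equiv {G} {D₁} {D₂} D₁~D₂ D₁-rank , deg₂≡2) ,
      λ D' _ → gon≥2 D'
    where
    deg₂≡2 : degree {G} D₂ ≡ + 2
    deg₂≡2 = trans (sym (Equiv⇒degree≡ {G} {D₁} {D₂} D₁~D₂)) (trans deg₁≡deg deg≡2)

  mfgon2⇒gon2 : MFGonalityIs G (+ 2) → GonalityIs G (+ 2)
  mfgon2⇒gon2 ((D , _ , D-rank , deg≡2) , mfgon≥2) = (D , D-rank , deg≡2) , gon≥2
    where
    gon≥2 : ∀ E → PositiveRank {G} E → + 2 ≤ degree {G} E
    gon≥2 E E-rank
      with E₁ , E₁≥0 , E₁-rank , deg₁≡deg ← positiveRank⇒effective {E} E-rank
      with + 2 ≤? degree {G} E₁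
    ... | yes 2≤deg₁ = ≤-trans 2≤deg₁ (≤-reflexive deg₁≡deg)
    ... | no 2≰deg₁  = contradiction
      (mfgon≥2 E₁ (effective-degree≤1⇒multFree E₁≥0 (i<j⇒i≤pred[j] (≰⇒> 2≰deg₁))) E₁-rank) 2≰deg₁

proposition3p3 : (G : Graph) → Connected G → GonalityIs G (+ 2) ⇔ MFGonalityIs G (+ 2)
proposition3p3 G conn = mk⇔ (gon2⇒mfgon2 {G} conn) (mfgon2⇒gon2 {G})
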